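{- Let $n>1$ and let $X$ be an automorphism-free SFT on $\mathbb{Z}^n$. Then $X$ is strongly aperiodic.
   Context: For a finite set $A$ and a group $G$, $A^G$ is the set of functions $G\to A$ with the product topology, with $G$-action $(g\cdot x)_h = x_{g^{ -1}h}$. A pattern is a partial function from $G$ to $A$ with finite support. A subshift of finite type (SFT) on $G$ is a set of the form $\{x\in A^G : \forall g\in G, \forall P\in\mathcal{P}, \exists h\in\mathrm{Supp}(P), (g\cdot x)_h\neq P_h\}$ for a finite set $\mathcal{P}$ of patterns. A subshift is strongly aperiodic if it is nonempty and every point $x$ has finite stabilizer $\{g : g\cdot x = x\}$. For an automorphism $\phi$ of $G$ and $x\in A^G$, define $\phi(x)\in A^G$ by $\phi(x)_g = x_{\phi(g)}$. For a subshift $X$ and a point $x$, $\mathrm{Div}(x,X) = \{\phi\in\mathrm{Aut}(G) : \phi(x)\in X\}$. A nonempty subshift $X$ is automorphism-free if $\mathrm{Div}(x,X)$ is trivial (equal to $\{\mathrm{id}\}$) for all $x\in X$. -}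

module Defs where

open import Data.Nat using (ℕ)
open import Data.Integer using (ℤ; _+_; _-_; -_)
open import Data.Fin using (Fin)
open import Data.Vec using (Vec; zipWith)
open import Data.List using (List)
open import Data.List.Relation.Unary.All using (All)
open import Data.List.Relation.Unary.Any using (Any)
open import Data.List.Membership.Propositional using (_∈_)
open import Data.Product using (Σ; _×_; ∃; ∃-syntax)
open import Relation.Binary.PropositionalEquality using (_≡_; _≢_)
open import Function using (_⇔_)
open import Level using (Level; 0ℓ)

ℤ^ : ℕ → Set
ℤ^ n = Vec ℤ n

_⊕_ : ∀ {n} → ℤ^ n → ℤ^ n → ℤ^ n
_⊕_ = zipWith _+_

_⊖_ : ∀ {n} → ℤ^ n → ℤ^ n → ℤ^ n
_⊖_ = zipWith _-_

Config : ℕ → ℕ → Set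
Config n k = ℤ^ n → Fin k

-- Shift action: (g · x)_h = x_{g⁻¹ h} = x (h - g).
_·_ : ∀ {n k} → ℤ^ n → Config n k → Config n k
(g · x) h = x (h ⊖ g)

-- A pattern: a finite support (given as a list) and the values on it
-- (values outside the support are irrelevant).
record Pattern (n k : ℕ) : Set where
  field
    supp : List (ℤ^ n)
    val  : ℤ^ n → Fin k
open Pattern public

AvoidsAt : ∀ {n k} → Config n k → ℤ^ n → Pattern n k → Set
AvoidsAt x g P = Any (λ h → (g · x) h ≢ val P h) (supp P)

IsSFT : ∀ {n k} → (Config n k → Set) → Set
IsSFT {n} {k} X = Σ (List (Pattern n k)) λ 𝒫 →
  ∀ (x : Config n k) → X x ⇔ (∀ (g : ℤ^ n) → All (AvoidsAt x g) 𝒫)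

record Aut (n : ℕ) : Set where
  field
    fun   : ℤ^ n → ℤ^ n
    inv   : ℤ^ n → ℤ^ n
    hom   : ∀ a b → fun (a ⊕ b) ≡ fun a ⊕ fun b
    linv  : ∀ a → inv (fun a) ≡ a
    rinv  : ∀ a → fun (inv a) ≡ a
open Aut public

act : ∀ {n k} → Aut n → Config n k → Config n k
act φ x g = x (fun φ g)

IsIdAut : ∀ {n} → Aut n → Set
IsIdAut φ = ∀ g → fun φ g ≡ g

Nonempty : ∀ {n k} → (Config n k → Set) → Set
Nonempty X = ∃[ x ] X x

-- Div(x,X) is trivial for all x ∈ X (it always contains id).
AutomorphismFree : ∀ {n k} → (Config n k → Set) → Set
AutomorphismFree {n} {k} X =
  Nonempty X × (∀ (x : Config n k) → X x → ∀ (φ : Aut n) → X (act φ x) → IsIdAut φ)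

Stabilizes : ∀ {n k} → ℤ^ n → Config n k → Set
Stabilizes g x = ∀ h → (g · x) h ≡ x h

FiniteStabilizer : ∀ {n k} → Config n k → Set
FiniteStabilizer {n} x = Σ (List (ℤ^ n)) λ L → ∀ g → Stabilizes g x → g ∈ L

StronglyAperiodic : ∀ {n k} → (Config n k → Set) → Set
StronglyAperiodic {n} {k} X =
  Nonempty X × (∀ (x : Config n k) → X x → FiniteStabilizer x)

module Submission where

-- Suppose g stabilizes a point x of X and fix a coordinate j. Since n > 1 there is an index i ≠ j,
-- and the transvection τ h = h + (gⱼ hᵢ − gᵢ hⱼ) g is an automorphism of ℤⁿ. It only moves h along
-- ℤ g, so τ(x) = x ∈ X because x is g-periodic; automorphism-freeness makes τ the identity, and
-- evaluating at the unit vector eᵢ gives gⱼ² = 0. Hence every stabilizer is trivial. Of the SFT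
-- hypothesis only the fact that membership in X depends on the values of a configuration is used.

open import Defs
open import Data.Nat using (ℕ; suc; _<_; s≤s; z≤n)
open import Data.Integer using (ℤ; +_; -[1+_]; 0ℤ; 1ℤ; _+_; _-_; _*_; -_)
open import Data.Integer.Properties using (+-identityˡ; +-identityʳ; neg-involutive; i*j≡0⇒i≡0∨j≡0)
open import Data.Integer.Tactic.RingSolver using (solve-∀)
open import Data.Fin using (Fin; zero; punchIn)
open import Data.Fin.Properties using (punchInᵢ≢i)
open import Data.Vec using (lookup; map; replicate; _[_]≔_)
open import Data.Vec.Properties using (lookup-zipWith; lookup-map; lookup-replicate; lookup∘update; lookup∘update′)
open import Data.Vec.Relation.Binary.Pointwise.Extensional using (ext; Pointwise-≡⇒≡)
open import Data.List using ([]; _∷_)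
open import Data.List.Relation.Unary.Any using (here)
import Data.List.Relation.Unary.Any as Any
import Data.List.Relation.Unary.All as All
open import Data.Product using (_,_)
open import Data.Sum using ([_,_]′)
open import Function using (Equivalence; id; _∘_)
open import Relation.Binary.PropositionalEquality
open ≡-Reasoning

_*ᵥ_ : ∀ {n} → ℤ → ℤ^ n → ℤ^ n
c *ᵥ v = map (c *_) v

infixl 25 _*ᵥ_

lookup-ext : ∀ {n} {u v : ℤ^ n} → (∀ t → lookup u t ≡ lookup v t) → u ≡ v
lookup-ext p = Pointwise-≡⇒≡ (ext p)

lookup-⊕ : ∀ {n} (u v : ℤ^ n) t → lookup (u ⊕ v) t ≡ lookup u t + lookup v t
lookup-⊕ u v t = lookup-zipWith _+_ t u v

lookup-⊖ : ∀ {n} (u v : ℤ^ n) t → lookup (u ⊖ v) t ≡ lookup u t - lookup v t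
lookup-⊖ u v t = lookup-zipWith _-_ t u v

lookup-⊕-*ᵥ : ∀ {n} (h : ℤ^ n) c g t → lookup (h ⊕ c *ᵥ g) t ≡ lookup h t + c * lookup g t
lookup-⊕-*ᵥ h c g t = trans (lookup-⊕ h (c *ᵥ g) t) (cong (λ b → lookup h t + b) (lookup-map t (c *_) g))

⊕-*ᵥ-cancel : ∀ {n} (h : ℤ^ n) c g → (h ⊕ c *ᵥ g) ⊕ (- c) *ᵥ g ≡ h
⊕-*ᵥ-cancel h c g = lookup-ext λ t → begin
  lookup ((h ⊕ c *ᵥ g) ⊕ (- c) *ᵥ g) t             ≡⟨ lookup-⊕-*ᵥ (h ⊕ c *ᵥ g) (- c) g t ⟩
  lookup (h ⊕ c *ᵥ g) t + (- c) * lookup g t       ≡⟨ cong (_+ (- c) * lookup g t) (lookup-⊕-*ᵥ h c g t) ⟩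
  lookup h t + c * lookup g t + (- c) * lookup g t ≡⟨ cancel (lookup h t) c (lookup g t) ⟩
  lookup h t                                       ∎
  where
  cancel : ∀ a c b → a + c * b + (- c) * b ≡ a
  cancel = solve-∀

sft-respects-≗ : ∀ {n k} {X : Config n k → Set} → IsSFT X →
  ∀ {x y} → X x → x ≗ y → X y
sft-respects-≗ (_ , X⇔avoids) {x} {y} x∈X x≗y =
  Equivalence.from (X⇔avoids y) λ g →
    All.map (Any.map λ x≢P y≡P → x≢P (trans (x≗y _) y≡P)) (Equivalence.to (X⇔avoids x) x∈X g)

module _ {n k} {x : Config n k} {g : ℤ^ n} (stab : Stabilizes g x) where

  private
    suc-step : ∀ c h → x (h ⊕ (1ℤ + c) *ᵥ g) ≡ x (h ⊕ c *ᵥ g)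
    suc-step c h = trans (sym (stab _)) (cong x (lookup-ext λ t → begin
      lookup ((h ⊕ (1ℤ + c) *ᵥ g) ⊖ g) t              ≡⟨ lookup-⊖ (h ⊕ (1ℤ + c) *ᵥ g) g t ⟩
      lookup (h ⊕ (1ℤ + c) *ᵥ g) t - lookup g t       ≡⟨ cong (_- lookup g t) (lookup-⊕-*ᵥ h (1ℤ + c) g t) ⟩
      lookup h t + (1ℤ + c) * lookup g t - lookup g t ≡⟨ absorb (lookup h t) c (lookup g t) ⟩
      lookup h t + c * lookup g t                     ≡⟨ lookup-⊕-*ᵥ h c g t ⟨
      lookup (h ⊕ c *ᵥ g) t                           ∎))
      where
      absorb : ∀ a c b → a + (1ℤ + c) * b - b ≡ a + c * b
      absorb = solve-∀

  -- Recursion along c ↦ 1ℤ + c, which computes to + suc m on + m and to -[1+ m ] on -[1+ suc m ].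
  stabilizer-invariant : ∀ c h → x (h ⊕ c *ᵥ g) ≡ x h
  stabilizer-invariant (+ 0)          h = cong x (lookup-ext λ t →
    trans (lookup-⊕-*ᵥ h (+ 0) g t) (+-identityʳ (lookup h t)))
  stabilizer-invariant (+ suc m)      h = trans (suc-step (+ m) h) (stabilizer-invariant (+ m) h)
  stabilizer-invariant -[1+ 0 ]       h = trans (sym (suc-step -[1+ 0 ] h)) (stabilizer-invariant (+ 0) h)
  stabilizer-invariant -[1+ suc m ]   h = trans (sym (suc-step -[1+ suc m ] h)) (stabilizer-invariant -[1+ m ] h)

module Transvection {n} (f : ℤ^ n → ℤ) (g : ℤ^ n)
  (f-additive : ∀ u v → f (u ⊕ v) ≡ f u + f v)
  (f-annihilates : ∀ c → f (c *ᵥ g) ≡ 0ℤ) where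

  f-⊕-*ᵥ : ∀ h c → f (h ⊕ c *ᵥ g) ≡ f h
  f-⊕-*ᵥ h c = begin
    f (h ⊕ c *ᵥ g)   ≡⟨ f-additive h (c *ᵥ g) ⟩
    f h + f (c *ᵥ g) ≡⟨ cong (λ b → f h + b) (f-annihilates c) ⟩
    f h + 0ℤ         ≡⟨ +-identityʳ (f h) ⟩
    f h              ∎

  transvection : Aut n
  transvection = record
    { fun  = λ h → h ⊕ f h *ᵥ g
    ; inv  = λ h → h ⊕ (- f h) *ᵥ g
    ; hom  = transvection-hom
    ; linv = transvection-linv
    ; rinv = transvection-rinv
    }
    where
    transvection-linv : ∀ h → (h ⊕ f h *ᵥ g) ⊕ (- f (h ⊕ f h *ᵥ g)) *ᵥ g ≡ h
    transvection-linv h =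
      trans (cong (λ c → (h ⊕ f h *ᵥ g) ⊕ (- c) *ᵥ g) (f-⊕-*ᵥ h (f h))) (⊕-*ᵥ-cancel h (f h) g)

    transvection-rinv : ∀ h → (h ⊕ (- f h) *ᵥ g) ⊕ f (h ⊕ (- f h) *ᵥ g) *ᵥ g ≡ h
    transvection-rinv h =
      trans (cong (λ c → (h ⊕ (- f h) *ᵥ g) ⊕ c *ᵥ g) (trans (f-⊕-*ᵥ h (- f h)) (sym (neg-involutive (f h)))))
            (⊕-*ᵥ-cancel h (- f h) g)

    transvection-hom : ∀ u v → (u ⊕ v) ⊕ f (u ⊕ v) *ᵥ g ≡ (u ⊕ f u *ᵥ g) ⊕ (v ⊕ f v *ᵥ g)
    transvection-hom u v = lookup-ext λ t → begin
      lookup ((u ⊕ v) ⊕ f (u ⊕ v) *ᵥ g) t                ≡⟨ lookup-⊕-*ᵥ (u ⊕ v) (f (u ⊕ v)) g t ⟩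
      lookup (u ⊕ v) t + f (u ⊕ v) * lookup g t          ≡⟨ cong₂ (λ a c → a + c * lookup g t) (lookup-⊕ u v t) (f-additive u v) ⟩
      lookup u t + lookup v t + (f u + f v) * lookup g t ≡⟨ regroup (lookup u t) (lookup v t) (f u) (f v) (lookup g t) ⟩
      (lookup u t + f u * lookup g t) + (lookup v t + f v * lookup g t)
        ≡⟨ cong₂ _+_ (lookup-⊕-*ᵥ u (f u) g t) (lookup-⊕-*ᵥ v (f v) g t) ⟨
      lookup (u ⊕ f u *ᵥ g) t + lookup (v ⊕ f v *ᵥ g) t       ≡⟨ lookup-⊕ (u ⊕ f u *ᵥ g) (v ⊕ f v *ᵥ g) t ⟨
      lookup ((u ⊕ f u *ᵥ g) ⊕ (v ⊕ f v *ᵥ g)) t              ∎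
      where
      regroup : ∀ a b c d e → a + b + (c + d) * e ≡ (a + c * e) + (b + d * e)
      regroup = solve-∀

  transvection-id⇒ : IsIdAut transvection → ∀ h t → lookup h t ≡ 0ℤ → f h * lookup g t ≡ 0ℤ
  transvection-id⇒ τ≡id h t hₜ≡0 = begin
    f h * lookup g t              ≡⟨ +-identityˡ (f h * lookup g t) ⟨
    0ℤ + f h * lookup g t         ≡⟨ cong (λ a → a + f h * lookup g t) hₜ≡0 ⟨
    lookup h t + f h * lookup g t ≡⟨ lookup-⊕-*ᵥ h (f h) g t ⟨
    lookup (h ⊕ f h *ᵥ g) t       ≡⟨ cong (λ v → lookup v t) (τ≡id h) ⟩
    lookup h t                    ≡⟨ hₜ≡0 ⟩
    0ℤ                            ∎

minor : ∀ {n} (i j : Fin n) → ℤ^ n → ℤ^ n → ℤ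
minor i j g h = lookup g j * lookup h i - lookup g i * lookup h j

minor-additive : ∀ {n} (i j : Fin n) g u v → minor i j g (u ⊕ v) ≡ minor i j g u + minor i j g v
minor-additive i j g u v = begin
  minor i j g (u ⊕ v)             ≡⟨ cong₂ (λ a b → lookup g j * a - lookup g i * b) (lookup-⊕ u v i) (lookup-⊕ u v j) ⟩
  gⱼ * (uᵢ + vᵢ) - gᵢ * (uⱼ + vⱼ) ≡⟨ expand gᵢ gⱼ uᵢ uⱼ vᵢ vⱼ ⟩
  minor i j g u + minor i j g v   ∎
  where
  gᵢ gⱼ uᵢ uⱼ vᵢ vⱼ : ℤ
  gᵢ = lookup g i ; gⱼ = lookup g j ; uᵢ = lookup u i ; uⱼ = lookup u j ; vᵢ = lookup v i ; vⱼ = lookup v j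
  expand : ∀ gᵢ gⱼ uᵢ uⱼ vᵢ vⱼ → gⱼ * (uᵢ + vᵢ) - gᵢ * (uⱼ + vⱼ) ≡ (gⱼ * uᵢ - gᵢ * uⱼ) + (gⱼ * vᵢ - gᵢ * vⱼ)
  expand = solve-∀

minor-self : ∀ {n} (i j : Fin n) g c → minor i j g (c *ᵥ g) ≡ 0ℤ
minor-self i j g c = begin
  minor i j g (c *ᵥ g)          ≡⟨ cong₂ (λ a b → lookup g j * a - lookup g i * b) (lookup-map i (c *_) g) (lookup-map j (c *_) g) ⟩
  gⱼ * (c * gᵢ) - gᵢ * (c * gⱼ) ≡⟨ alternating gᵢ gⱼ c ⟩
  0ℤ                            ∎
  where
  gᵢ gⱼ : ℤ
  gᵢ = lookup g i ; gⱼ = lookup g j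
  alternating : ∀ gᵢ gⱼ c → gⱼ * (c * gᵢ) - gᵢ * (c * gⱼ) ≡ 0ℤ
  alternating = solve-∀

unit : ∀ {n} → Fin n → ℤ^ n
unit {n} i = replicate n 0ℤ [ i ]≔ 1ℤ

lookup-unit-≢ : ∀ {n} {i j : Fin n} → j ≢ i → lookup (unit i) j ≡ 0ℤ
lookup-unit-≢ {n} {i} {j} j≢i = trans (lookup∘update′ j≢i (replicate n 0ℤ) 1ℤ) (lookup-replicate j 0ℤ)

minor-unit : ∀ {n} {i j : Fin n} → j ≢ i → ∀ g → minor i j g (unit i) ≡ lookup g j
minor-unit {n} {i} {j} j≢i g = begin
  minor i j g (unit i) ≡⟨ cong₂ (λ a b → lookup g j * a - lookup g i * b) (lookup∘update i (replicate n 0ℤ) 1ℤ) (lookup-unit-≢ j≢i) ⟩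
  gⱼ * 1ℤ - gᵢ * 0ℤ    ≡⟨ simplify gᵢ gⱼ ⟩
  gⱼ                   ∎
  where
  gᵢ gⱼ : ℤ
  gᵢ = lookup g i ; gⱼ = lookup g j
  simplify : ∀ gᵢ gⱼ → gⱼ * 1ℤ - gᵢ * 0ℤ ≡ gⱼ
  simplify = solve-∀

stabilizer-trivial : ∀ {m k} {X : Config (suc (suc m)) k → Set} → IsSFT X → AutomorphismFree X →
  ∀ {x g} → X x → Stabilizes g x → g ≡ replicate (suc (suc m)) 0ℤ
stabilizer-trivial {m} {X = X} sft (_ , aut-free) {x} {g} x∈X stab =
  lookup-ext λ j → trans (gⱼ≡0 j) (sym (lookup-replicate j 0ℤ))
  where
  gⱼ≡0 : ∀ j → lookup g j ≡ 0ℤ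
  gⱼ≡0 j = [ id , id ]′ (i*j≡0⇒i≡0∨j≡0 (lookup g j) gⱼ²≡0)
    where
    i : Fin (suc (suc m))
    i = punchIn j zero
    j≢i : j ≢ i
    j≢i = punchInᵢ≢i j zero ∘ sym
    open Transvection (minor i j g) g (minor-additive i j g) (minor-self i j g)
    τx∈X : X (act transvection x)
    τx∈X = sft-respects-≗ sft x∈X λ h → sym (stabilizer-invariant stab (minor i j g h) h)
    gⱼ²≡0 : lookup g j * lookup g j ≡ 0ℤ
    gⱼ²≡0 = trans (cong (_* lookup g j) (sym (minor-unit j≢i g)))
      (transvection-id⇒ (aut-free x x∈X transvection τx∈X) (unit i) j (lookup-unit-≢ j≢i))

proposition6 : (n : ℕ) → 1 < n → (k : ℕ) → (X : Config n k → Set) →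
    IsSFT X → AutomorphismFree X → StronglyAperiodic X
proposition6 (suc (suc m)) (s≤s (s≤s z≤n)) k X sft aut-free@(nonempty , _) =
  nonempty , λ x x∈X → replicate (suc (suc m)) 0ℤ ∷ [] , λ g stab → here (stabilizer-trivial sft aut-free x∈X stab)
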